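{- For every integer $n\geq 3$, the undirected binary de Bruijn graph $\mathcal{B}(2,n)$ is $1$-identifiable.
   Context: The undirected de Bruijn graph $\mathcal{B}(2,n)$ has vertex set the set of all binary strings of length $n$, and for each binary string $x_1x_2\ldots x_{n+1}$ an (undirected) edge joining $x_1\ldots x_n$ and $x_2\ldots x_{n+1}$. For a vertex $x$, $B_1(x)$ is the set of vertices at graph distance at most $1$ from $x$. A subset $S$ of vertices is a $1$-identifying code if $B_1(x)\cap S\neq\emptyset$ for every vertex $x$ and $B_1(x)\cap S\neq B_1(y)\cap S$ for all distinct vertices $x,y$; the graph is $1$-identifiable (identifiable) if such a code exists. -}

module Defs where

open import Data.Bool using (Bool; true; false)
open import Data.Nat using (ℕ; suc)
open import Data.Vec using (Vec; init; tail)
open import Data.Product using (Σ; ∃; _×_)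
open import Data.Sum using (_⊎_)
open import Relation.Nullary using (¬_)
open import Relation.Binary.PropositionalEquality using (_≡_)
open import Function.Bundles using (_⇔_)

Vertex : ℕ → Set
Vertex n = Vec Bool n

Edge : (n : ℕ) → Vertex n → Vertex n → Set
Edge n x y = Σ (Vec Bool (suc n)) λ w → init w ≡ x × tail w ≡ y

Adjacent : (n : ℕ) → Vertex n → Vertex n → Set
Adjacent n x y = Edge n x y ⊎ Edge n y x

InBall : (n : ℕ) → Vertex n → Vertex n → Set
InBall n x z = z ≡ x ⊎ Adjacent n x z

VSet : ℕ → Set
VSet n = Vertex n → Bool

IsIdentifyingCode : (n : ℕ) → VSet n → Set
IsIdentifyingCode n S =
  ((x : Vertex n) → ∃ λ z → S z ≡ true × InBall n x z)
  × ((x y : Vertex n) → ¬ x ≡ y →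
       ¬ ((z : Vertex n) → S z ≡ true → (InBall n x z ⇔ InBall n y z)))

Identifiable : ℕ → Set
Identifiable n = ∃ λ (S : VSet n) → IsIdentifyingCode n S

-- Take every vertex as the code. It identifies exactly when no two distinct vertices have the
-- same closed neighbourhood, so it suffices to rule out such twins. Twins are adjacent, hence
-- of the form x = c·u and y = u·d. The out-neighbour u·d̄ of x must then be a neighbour of y,
-- which forces the overlap u to be constant; the few remaining configurations are separated
-- by an explicit vertex, and this is where n ≥ 3 is needed.
module Submission where

open import Defs
open import Data.Nat using (ℕ; suc; _+_; _≤_; s≤s; z≤n)
open import Data.Bool using (Bool; true; not; _≟_)
open import Data.Bool.Properties using (not-¬; ¬-not)
open import Data.Vec using (Vec; []; _∷_; _∷ʳ_; init; last; replicate; initLast)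
open import Data.Vec.Properties using (∷-injective; ∷-injectiveˡ; ∷-injectiveʳ; ∷ʳ-injective; ∷ʳ-injectiveˡ; ∷ʳ-injectiveʳ; init-∷ʳ; last-∷ʳ)
open import Data.Product using (_×_; _,_)
open import Data.Sum using (inj₁; inj₂)
open import Function using (_∘_)
open import Function.Bundles using (_⇔_; Equivalence)
open import Function.Properties.Equivalence using () renaming (sym to ⇔-sym)
open import Relation.Nullary using (¬_; yes; no)
open import Relation.Binary.PropositionalEquality using (_≡_; _≢_; refl; sym; trans; cong; subst; module ≡-Reasoning)

private
  variable
    A : Set
    k m : ℕ

replicate-∷ʳ : ∀ k (a : A) → replicate (suc k) a ≡ replicate k a ∷ʳ a
replicate-∷ʳ 0       a = refl
replicate-∷ʳ (suc k) a = cong (a ∷_) (replicate-∷ʳ k a)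

last-replicate : ∀ k (a : A) → last (replicate (suc k) a) ≡ a
last-replicate k a = trans (cong last (replicate-∷ʳ k a)) (last-∷ʳ a (replicate k a))

init-replicate : ∀ k (a : A) → init (replicate (suc k) a) ≡ replicate k a
init-replicate k a = trans (cong init (replicate-∷ʳ k a)) (init-∷ʳ a (replicate k a))

∷ʳ≡∷⇒replicate : (u : Vec A k) {c e : A} → u ∷ʳ e ≡ c ∷ u → u ≡ replicate k e × c ≡ e
∷ʳ≡∷⇒replicate []      refl = refl , refl
∷ʳ≡∷⇒replicate (a ∷ u) eq with ∷-injective eq
... | refl , eq′ with ∷ʳ≡∷⇒replicate u eq′
...   | refl , refl = refl , refl

not-b≢b : ∀ {b} → not b ≢ b
not-b≢b = not-¬ refl ∘ sym

record Shift (x y : Vertex (suc k)) : Set where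
  constructor shift
  field
    head′  : Bool
    middle : Vec Bool k
    last′  : Bool
    x≡     : x ≡ head′ ∷ middle
    y≡     : y ≡ middle ∷ʳ last′

shift⇒edge : {x y : Vertex (suc k)} → Shift x y → Edge (suc k) x y
shift⇒edge (shift c u d refl refl) = c ∷ (u ∷ʳ d) , init-∷ʳ d (c ∷ u) , refl

edge⇒shift : {x y : Vertex (suc k)} → Edge (suc k) x y → Shift x y
edge⇒shift (c ∷ t , refl , refl) with initLast t
... | u , d , refl = shift c u d refl refl

pattern centre     = inj₁ refl
pattern outgoing e = inj₂ (inj₁ e)
pattern incoming e = inj₂ (inj₂ e)

Twins : (n : ℕ) → Vertex n → Vertex n → Set
Twins n x y = (z : Vertex n) → InBall n x z ⇔ InBall n y z

twins-sym : ∀ {n} {x y : Vertex n} → Twins n x y → Twins n y x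
twins-sym twins z = ⇔-sym (twins z)

twin-free⇒identifiable : ∀ n → (∀ (x y : Vertex n) → x ≢ y → ¬ Twins n x y) → Identifiable n
twin-free⇒identifiable n twin-free =
  (λ _ → true) , (λ x → x , refl , centre) , λ x y x≢y same → twin-free x y x≢y (λ z → same z refl)

flipped-head-not-twins : ∀ m b → ¬ Twins (3 + m) (not b ∷ replicate (2 + m) b) (replicate (3 + m) b)
flipped-head-not-twins m b twins with Equivalence.to (twins z) (incoming z→x)
  where
  z = b ∷ not b ∷ replicate (1 + m) b
  z→x : Edge _ z (not b ∷ replicate (2 + m) b)
  z→x = shift⇒edge (shift b _ b refl (cong (not b ∷_) (replicate-∷ʳ (1 + m) b)))
... | inj₁ z≡y = not-b≢b (∷-injectiveˡ (∷-injectiveʳ z≡y))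
... | outgoing y→z with edge⇒shift y→z
...   | shift _ _ _ refl z≡ = not-b≢b (∷-injectiveˡ (∷-injectiveʳ z≡))
flipped-head-not-twins m b twins | incoming z→y with edge⇒shift z→y
...   | shift _ _ _ refl y≡ = not-b≢b (sym (∷-injectiveˡ y≡))

constant-middle-not-twins : ∀ m c {a b} → a ≢ b →
  ¬ Twins (3 + m) (c ∷ replicate (2 + m) a) (replicate (2 + m) a ∷ʳ b)
constant-middle-not-twins m c {a} {b} a≢b twins with Equivalence.from (twins z) (outgoing y→z)
  where
  z = replicate (1 + m) a ∷ʳ b ∷ʳ b
  y→z : Edge _ (replicate (2 + m) a ∷ʳ b) z
  y→z = shift⇒edge (shift a _ b refl refl)
... | inj₁ z≡x = a≢b (begin
  a                                    ≡⟨ sym (last-replicate (2 + m) a) ⟩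
  last (c ∷ replicate (2 + m) a)       ≡⟨ cong last z≡x ⟨
  last (replicate (1 + m) a ∷ʳ b ∷ʳ b) ≡⟨ last-∷ʳ b (replicate (1 + m) a ∷ʳ b) ⟩
  b                                    ∎)
  where open ≡-Reasoning
... | outgoing x→z with edge⇒shift x→z
...   | shift _ _ d refl z≡ = a≢b (begin
  a                               ≡⟨ sym (last-replicate (1 + m) a) ⟩
  last (replicate (2 + m) a)      ≡⟨ cong last (∷ʳ-injectiveˡ (replicate (1 + m) a ∷ʳ b) (replicate (2 + m) a) z≡) ⟨
  last (replicate (1 + m) a ∷ʳ b) ≡⟨ last-∷ʳ b (replicate (1 + m) a) ⟩
  b                               ∎)
  where open ≡-Reasoning
constant-middle-not-twins m c {a} {b} a≢b twins | incoming z→x with edge⇒shift z→x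
...   | shift _ w d refl x≡ = a≢b (begin
  a                                     ≡⟨ sym (last-replicate m a) ⟩
  last (replicate (1 + m) a)            ≡⟨ cong last (init-replicate (1 + m) a) ⟨
  last (init (c ∷ replicate (2 + m) a)) ≡⟨ cong (last ∘ init) x≡ ⟩
  last (init (w ∷ʳ d))                  ≡⟨ cong last (init-∷ʳ d w) ⟩
  last w                                ≡⟨ last-∷ʳ b (replicate m a ∷ʳ b) ⟩
  b                                     ∎)
  where open ≡-Reasoning

shift-not-twins : ∀ m c (u : Vec Bool (2 + m)) d → c ∷ u ≢ u ∷ʳ d → ¬ Twins (3 + m) (c ∷ u) (u ∷ʳ d)
shift-not-twins m c u d x≢y twins
  with Equivalence.to (twins (u ∷ʳ not d)) (outgoing (shift⇒edge (shift c u (not d) refl refl)))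
... | inj₁ z≡y = not-b≢b (∷ʳ-injectiveʳ u u z≡y)
... | outgoing y→z with edge⇒shift y→z
...   | shift _ w _ y≡ z≡ with ∷ʳ-injective u w z≡
...     | refl , _ with ∷ʳ≡∷⇒replicate u y≡
...       | refl , refl with c ≟ d
...         | yes refl = x≢y (replicate-∷ʳ (2 + m) d)
...         | no c≢d with ¬-not c≢d
...           | refl = flipped-head-not-twins m d (subst (Twins _ _) (sym (replicate-∷ʳ (2 + m) d)) twins)
shift-not-twins m c u d x≢y twins | incoming z→y with edge⇒shift z→y
...   | shift _ w _ z≡ y≡ with ∷ʳ-injective u w y≡
...     | refl , _ with ∷ʳ≡∷⇒replicate u z≡
...       | refl , _ = constant-middle-not-twins m c not-b≢b twins

edge-not-twins : {x y : Vertex (3 + m)} → Edge (3 + m) x y → x ≢ y → ¬ Twins (3 + m) x y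
edge-not-twins x→y with edge⇒shift x→y
... | shift c u d refl refl = shift-not-twins _ c u d

twin-free : (x y : Vertex (3 + m)) → x ≢ y → ¬ Twins (3 + m) x y
twin-free x y x≢y twins with Equivalence.to (twins x) centre
... | inj₁ x≡y     = x≢y x≡y
... | outgoing y→x = edge-not-twins y→x (x≢y ∘ sym) (twins-sym twins)
... | incoming x→y = edge-not-twins x→y x≢y twins

mainTheorem5 : (n : ℕ) → 3 ≤ n → Identifiable n
mainTheorem5 (suc (suc (suc m))) (s≤s (s≤s (s≤s z≤n))) = twin-free⇒identifiable (3 + m) twin-free
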